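{- Let $A$ be a finite alphabet with $|A|\ge2$, let $F=(A,S,\delta,s_0,S')$ be a deterministic finite automaton and let $\hat F$ be a deterministic finite automaton with $L(\hat F)=L(F)^R$. The following are equivalent: (1) $L(F)\in\mathcal{L}_1$; (2) neither $F$ nor $\hat F$ has the pattern P$_1$; (3) neither $F$ nor $\hat F$ has the pattern P$_2$; (4) $F$ does not have the pattern P$_3$.
   Context: $\mathcal{L}_{1/2}$ is the class of finite unions of languages $A^*a_1A^*\cdots A^*a_nA^*$ ($n\geq0$, $a_i\in A$), and $\mathcal{L}_1$ is its boolean closure (closure under finite union, finite intersection, complement in $A^*$). For $w=a_1\cdots a_n$, $w^R=a_n\cdots a_1$, and $L^R=\{w^R:w\in L\}$. Subword relation: $w\sqsubseteq v$ iff $w=a_1\cdots a_n$ and $v=v_0a_1v_1\cdots a_nv_n$ for some $n\ge0$, $a_i\in A$, $v_i\in A^*$. A dfa $(A,S,\delta,s_0,S')$ has transition function $\delta$ extended to words. Writing a dfa as $(A,S,\delta,s_0,S')$: - It has pattern P$_1$ if there exist $v,x,y,z\in A^*$, $a\in A$ and states $s_1,s_2,s_3$ with $ya\sqsubseteq v$, $\delta(s_0,x)=\delta(s_1,v)=s_1$, $\delta(s_1,y)=s_2$, $\delta(s_2,a)=s_3$, and $\delta(s_2,z)\in S'\iff\delta(s_3,z)\notin S'$. - It has pattern P$_2$ if there exist $u,x,z,z'\in A^*$, $a\in A$ and states $s_1,s_2,s_3,s_4$ with $az\sqsubseteq u$, $\delta(s_0,x)=s_1$, $\delta(s_1,a)=s_2$,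 $\delta(s_1,z)=\delta(s_3,u)=s_3$, $\delta(s_2,z)=\delta(s_4,u)=s_4$, and $\delta(s_3,z')\in S'\iff\delta(s_4,z')\notin S'$. - It has pattern P$_3$ if there exist $u,v,x,y,z,z'\in A^*$, $a\in A$ and states $s_1,\dots,s_5$ with ($ya\sqsubseteq v$ or $az\sqsubseteq u$), $\delta(s_0,x)=\delta(s_1,v)=s_1$, $\delta(s_1,y)=s_2$, $\delta(s_2,a)=s_3$, $\delta(s_2,z)=\delta(s_4,u)=s_4$, $\delta(s_3,z)=\delta(s_5,u)=s_5$, and $\delta(s_4,z')\in S'\iff\delta(s_5,z')\notin S'$. -}

module Defs where

open import Data.Nat using (ℕ)
open import Data.Fin using (Fin)
open import Data.Bool using (Bool; true)
open import Data.List using (List; []; _∷_; _++_; reverse; [_])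
open import Data.List.Relation.Unary.Any using (Any)
open import Data.List.Relation.Binary.Sublist.Propositional using (_⊆_)
open import Data.Product using (Σ; _×_; ∃)
open import Data.Sum using (_⊎_)
open import Relation.Nullary using (¬_)
open import Relation.Binary.PropositionalEquality using (_≡_; _≢_)
open import Function.Bundles using (_⇔_)

Word : ℕ → Set
Word k = List (Fin k)

Language : ℕ → Set₁
Language k = Word k → Set

_⊑_ : ∀ {k} → Word k → Word k → Set
w ⊑ v = w ⊆ v

_ᴿ : ∀ {k} → Language k → Language k
(L ᴿ) w = L (reverse w)

-- A*a₁A*⋯A*aₙA* = { v | a₁⋯aₙ ⊑ v }
Shuffle : ∀ {k} → Word k → Language k
Shuffle u v = u ⊑ v

-- Finite unions of such languages, given by a finite list of words (class L_{1/2})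
Union½ : ∀ {k} → List (Word k) → Language k
Union½ us v = Any (λ u → Shuffle u v) us

data BExp (k : ℕ) : Set where
  atom  : List (Word k) → BExp k
  _∪ᵇ_  : BExp k → BExp k → BExp k
  _∩ᵇ_  : BExp k → BExp k → BExp k
  compᵇ : BExp k → BExp k

⟦_⟧ : ∀ {k} → BExp k → Language k
⟦ atom us ⟧ v = Union½ us v
⟦ e ∪ᵇ f ⟧ v = ⟦ e ⟧ v ⊎ ⟦ f ⟧ v
⟦ e ∩ᵇ f ⟧ v = ⟦ e ⟧ v × ⟦ f ⟧ v
⟦ compᵇ e ⟧ v = ¬ ⟦ e ⟧ v

InL1 : ∀ {k} → Language k → Set
InL1 {k} L = Σ (BExp k) λ e → ∀ w → L w ⇔ ⟦ e ⟧ w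

record DFA (k : ℕ) : Set where
  field
    nStates : ℕ
    δ       : Fin nStates → Fin k → Fin nStates
    s₀      : Fin nStates
    final   : Fin nStates → Bool     -- S' = { s | final s ≡ true }

  State : Set
  State = Fin nStates

  δ* : State → Word k → State
  δ* s []       = s
  δ* s (a ∷ w) = δ* (δ s a) w

  Sep : State → State → Word k → Set
  Sep s s' z = final (δ* s z) ≢ final (δ* s' z)

open DFA public

L : ∀ {k} → DFA k → Language k
L F w = final F (δ* F (s₀ F) w) ≡ true

P₁ : ∀ {k} → DFA k → Set
P₁ {k} F =
  Σ (Word k) λ v → Σ (Word k) λ x → Σ (Word k) λ y → Σ (Word k) λ z → Σ (Fin k) λ a →
  Σ (State F) λ s₁ → Σ (State F) λ s₂ → Σ (State F) λ s₃ →
    ((y ++ [ a ]) ⊑ v)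
  × (δ* F (s₀ F) x ≡ s₁) × (δ* F s₁ v ≡ s₁)
  × (δ* F s₁ y ≡ s₂)
  × (δ F s₂ a ≡ s₃)
  × Sep F s₂ s₃ z

P₂ : ∀ {k} → DFA k → Set
P₂ {k} F =
  Σ (Word k) λ u → Σ (Word k) λ x → Σ (Word k) λ z → Σ (Word k) λ z' → Σ (Fin k) λ a →
  Σ (State F) λ s₁ → Σ (State F) λ s₂ → Σ (State F) λ s₃ → Σ (State F) λ s₄ →
    ((a ∷ z) ⊑ u)
  × (δ* F (s₀ F) x ≡ s₁)
  × (δ F s₁ a ≡ s₂)
  × (δ* F s₁ z ≡ s₃) × (δ* F s₃ u ≡ s₃)
  × (δ* F s₂ z ≡ s₄) × (δ* F s₄ u ≡ s₄)
  × Sep F s₃ s₄ z'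

P₃ : ∀ {k} → DFA k → Set
P₃ {k} F =
  Σ (Word k) λ u → Σ (Word k) λ v → Σ (Word k) λ x → Σ (Word k) λ y →
  Σ (Word k) λ z → Σ (Word k) λ z' → Σ (Fin k) λ a →
  Σ (State F) λ s₁ → Σ (State F) λ s₂ → Σ (State F) λ s₃ →
  Σ (State F) λ s₄ → Σ (State F) λ s₅ →
    (((y ++ [ a ]) ⊑ v) ⊎ ((a ∷ z) ⊑ u))
  × (δ* F (s₀ F) x ≡ s₁) × (δ* F s₁ v ≡ s₁)
  × (δ* F s₁ y ≡ s₂)
  × (δ F s₂ a ≡ s₃)
  × (δ* F s₂ z ≡ s₄) × (δ* F s₄ u ≡ s₄)
  × (δ* F s₃ z ≡ s₅) × (δ* F s₅ u ≡ s₅)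
  × Sep F s₄ s₅ z'

{-# OPTIONS --safe #-}
module Submission where

-- A language is in 𝓛₁ iff acceptance is invariant under Simon's congruence ∼ₙ (having
-- the same subwords of length ≤ n) for some n: a boolean combination of shuffle ideals
-- cannot separate ∼ₙ-equivalent words once n bounds its words, and conversely a
-- ∼ₙ-invariant language is the union of the ∼ₙ-classes of its short members, each a
-- boolean combination of shuffle ideals.  Each pattern yields two ∼ₙ-equivalent words,
-- one accepted and one rejected, by pumping its loop n times.
--
-- For the converse, say that a saturates p at n when every subword of p shorter than n
-- extends by a inside p.  Then p splits into n blocks whose alphabets contain a and grow
-- to the left, and by the pigeonhole principle the automaton loops on consecutive
-- blocks; so if F avoids P₁, deleting a from p a q does not change acceptance.  Dually,
-- avoiding P₂ (pigeonhole on pairs of states) allows deleting a letter that saturates q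
-- on the left, and reversal exchanges the two sides between F and F̂.  By Simon's lemma
-- such deletions give ∼₂ₙ-invariance: ∼₂ₙ-equivalent words have a common superword in
-- their class, and each letter deleted on the way down saturates one of its two sides.

open import Defs
open import Data.Bool using (Bool; true)
open import Data.Bool.Properties using (⇔→≡) renaming (_≟_ to _≟ᵇ_)
open import Data.Empty using (⊥-elim)
open import Data.Fin using (Fin; zero; suc; combine) renaming (_<_ to _<ᶠ_; _≟_ to _≟ᶠ_)
open import Data.Fin.Properties using (pigeonhole; combine-injectiveˡ; combine-injectiveʳ)
open import Data.List
  using (List; []; _∷_; _++_; [_]; length; reverse; map; filter; allFin; cartesianProductWith)
open import Data.List.Properties
  using ( ++-assoc; ++-identityʳ; ∷ʳ-++; length-++; length-reverse
        ; reverse-++; reverse-involutive; unfold-reverse)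
open import Data.List.Membership.Propositional using (_∈_; _∉_; find; lose)
open import Data.List.Membership.Propositional.Properties
  using ( ∈-++⁺ˡ; ∈-++⁺ʳ; ∈-++⁻; ∈-allFin; ∈-filter⁺; ∈-filter⁻
        ; ∈-cartesianProductWith⁺; ∈-cartesianProductWith⁻)
open import Data.List.Relation.Unary.Any using (Any; here; there)
import Data.List.Relation.Unary.Any.Properties as Any
open import Data.List.Relation.Unary.All using (All; all?)
import Data.List.Relation.Unary.All as All
import Data.List.Relation.Unary.All.Properties as All
open import Data.List.Relation.Binary.Sublist.Propositional
  using (_⊆_; []; _∷_; _∷ʳ_; ⊆-refl; ⊆-trans; minimum; from∈; lookup; ⊆-upper-bound; UpperBound)
open import Data.List.Relation.Binary.Sublist.Propositional.Properties
  using (++⁺; ++⁺ˡ; ++⁺ʳ; reverse⁺; length-mono-≤; ∷ˡ⁻; ∷⁻)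
open import Data.List.Relation.Binary.Subset.Propositional using () renaming (_⊆_ to _⊆ₛ_)
open import Data.Nat using (ℕ; zero; suc; _+_; _*_; _⊔_; _≤_; _<_; _≥_; s≤s; z≤n)
open import Data.Nat.ListAction using (sum)
open import Data.Nat.Properties
  using ( ≤-refl; ≤-reflexive; ≤-trans; <-≤-trans; <⇒≤; ≰⇒>; _≤?_; 1+n≰n; n≤1+n; m≤m+n; m≤n+m
        ; +-comm; +-suc; +-mono-≤; +-monoʳ-≤; m≤m⊔n; m≤n⊔m; m⊔n≤o⇒m≤o; m⊔n≤o⇒n≤o; module ≤-Reasoning)
open import Data.Product using (_×_; _,_; ∃-syntax; Σ-syntax; ∃₂)
import Data.Product as Product
open import Data.Sum using (_⊎_; inj₁; inj₂)
import Data.Sum as Sum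
open import Function using (_∘_; id; const)
open import Function.Bundles using (_⇔_; mk⇔; Equivalence)
open import Relation.Binary.Core using (_Preserves_⟶_)
open import Relation.Binary.Definitions using (DecidableEquality)
open import Relation.Binary.PropositionalEquality
  using (_≡_; _≢_; refl; sym; trans; cong; subst; subst₂; module ≡-Reasoning)
open import Relation.Nullary using (¬_; Dec; yes; no)
open import Relation.Nullary.Decidable using (_→-dec_; decidable-stable)
open import Relation.Unary using (Decidable)

-- Subwords

module _ {A : Set} where

  ⊆-++⁻ : ∀ p {q s : List A} → s ⊆ p ++ q → ∃₂ λ s₁ s₂ → s ≡ s₁ ++ s₂ × s₁ ⊆ p × s₂ ⊆ q
  ⊆-++⁻ []      τ          = [] , _ , refl , [] , τ
  ⊆-++⁻ (c ∷ p) (.c ∷ʳ τ)  with s₁ , s₂ , refl , τ₁ , τ₂ ← ⊆-++⁻ p τ = s₁ , s₂ , refl , c ∷ʳ τ₁ , τ₂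
  ⊆-++⁻ (c ∷ p) (refl ∷ τ) with s₁ , s₂ , refl , τ₁ , τ₂ ← ⊆-++⁻ p τ = c ∷ s₁ , s₂ , refl , refl ∷ τ₁ , τ₂

  ⊆-++-∷⁻ : ∀ (α : List A) {c β} p {q} → α ++ c ∷ β ⊆ p ++ q → α ++ [ c ] ⊆ p ⊎ c ∷ β ⊆ q
  ⊆-++-∷⁻ α       []      τ          = inj₂ (⊆-trans (++⁺ˡ α ⊆-refl) τ)
  ⊆-++-∷⁻ []      (d ∷ p) (.d ∷ʳ τ)  = Sum.map₁ (d ∷ʳ_) (⊆-++-∷⁻ [] p τ)
  ⊆-++-∷⁻ []      (d ∷ p) (refl ∷ τ) = inj₁ (refl ∷ minimum p)
  ⊆-++-∷⁻ (a ∷ α) (d ∷ p) (.d ∷ʳ τ)  = Sum.map₁ (d ∷ʳ_) (⊆-++-∷⁻ (a ∷ α) p τ)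
  ⊆-++-∷⁻ (_ ∷ α) (d ∷ p) (refl ∷ τ) = Sum.map₁ (refl ∷_) (⊆-++-∷⁻ α p τ)

  ⊆-insert⁻ : ∀ p {a : A} {q s} → s ⊆ p ++ a ∷ q →
              s ⊆ p ++ q ⊎ ∃₂ λ α γ → s ≡ α ++ a ∷ γ × α ⊆ p × γ ⊆ q
  ⊆-insert⁻ p τ with ⊆-++⁻ p τ
  ... | _ , _ , refl , τ₁ , _ ∷ʳ τ₂   = inj₁ (++⁺ τ₁ τ₂)
  ... | α , _ , refl , τ₁ , refl ∷ τ₂ = inj₂ (α , _ , refl , τ₁ , τ₂)

  length-snoc : ∀ (s : List A) a → length (s ++ [ a ]) ≡ suc (length s)
  length-snoc s a = trans (length-++ s) (+-comm (length s) 1)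

  snoc⊈ : ∀ (t : List A) {a} → ¬ t ++ [ a ] ⊆ t
  snoc⊈ t {a} τ = 1+n≰n (subst (_≤ length t) (length-snoc t a) (length-mono-≤ τ))

  reverse-insert : ∀ p (a : A) q → reverse (p ++ a ∷ q) ≡ reverse q ++ a ∷ reverse p
  reverse-insert p a q =
    trans (reverse-++ p (a ∷ q))
          (trans (cong (_++ reverse p) (unfold-reverse a q)) (∷ʳ-++ (reverse q) a (reverse p)))

  ⊆reverse⇒reverse⊆ : ∀ {s w : List A} → s ⊆ reverse w → reverse s ⊆ w
  ⊆reverse⇒reverse⊆ {w = w} τ = subst (_ ⊆_) (reverse-involutive w) (reverse⁺ τ)

  upper-bound-length : ∀ {xs ys zs : List A} (τ : xs ⊆ zs) (σ : ys ⊆ zs) →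
                       length (UpperBound.theUpperBound (⊆-upper-bound τ σ)) ≤ length xs + length ys
  upper-bound-length []       []       = z≤n
  upper-bound-length (_ ∷ʳ τ) (_ ∷ʳ σ) = upper-bound-length τ σ
  upper-bound-length {xs} (_ ∷ʳ τ) (_∷_ {xs = ys} _ σ) =
    ≤-trans (s≤s (upper-bound-length τ σ)) (≤-reflexive (sym (+-suc (length xs) (length ys))))
  upper-bound-length (_ ∷ τ)  (_ ∷ʳ σ) = s≤s (upper-bound-length τ σ)
  upper-bound-length {_ ∷ xs} (_ ∷ τ) (_∷_ {xs = ys} _ σ) =
    s≤s (≤-trans (upper-bound-length τ σ)
                 (≤-trans (n≤1+n _) (≤-reflexive (sym (+-suc (length xs) (length ys))))))

  all-or-counterexample : ∀ {P : A → Set} → Decidable P → ∀ xs → All P xs ⊎ ∃[ x ] x ∈ xs × ¬ P x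
  all-or-counterexample P? xs with all? P? xs
  ... | yes all = inj₁ all
  ... | no ¬all = inj₂ (find (All.¬All⇒Any¬ P? xs ¬all))

  infixl 10 _^_
  _^_ : List A → ℕ → List A
  v ^ zero  = []
  v ^ suc n = v ++ v ^ n

  ^-mono : ∀ {v : List A} {m n} → m ≤ n → v ^ m ⊆ v ^ n
  ^-mono {v} {zero}  {n}     _         = minimum (v ^ n)
  ^-mono {v} {suc m} {suc n} (s≤s m≤n) = ++⁺ ⊆-refl (^-mono m≤n)

  ^-⊆ₛ : ∀ (v : List A) n → v ^ n ⊆ₛ v
  ^-⊆ₛ v (suc n) c∈ = Sum.[ id , ^-⊆ₛ v n ] (∈-++⁻ v c∈)

  ⊆ₛ⇒⊆^ : ∀ (s : List A) {v} → s ⊆ₛ v → s ⊆ v ^ length s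
  ⊆ₛ⇒⊆^ []      _   = minimum _
  ⊆ₛ⇒⊆^ (c ∷ s) s⊆v = ++⁺ (from∈ (s⊆v (here refl))) (⊆ₛ⇒⊆^ s (s⊆v ∘ there))

-- Simon's congruence

module _ {A : Set} where

  infix 4 _≲[_]_ _∼[_]_

  _≲[_]_ : List A → ℕ → List A → Set
  u ≲[ n ] v = ∀ {s} → length s ≤ n → s ⊆ u → s ⊆ v

  _∼[_]_ : List A → ℕ → List A → Set
  u ∼[ n ] v = u ≲[ n ] v × v ≲[ n ] u

  ⊆⇒≲ : ∀ {u v : List A} {n} → u ⊆ v → u ≲[ n ] v
  ⊆⇒≲ u⊆v _ s⊆u = ⊆-trans s⊆u u⊆v

  ≲-trans : ∀ {u v w : List A} {n} → u ≲[ n ] v → v ≲[ n ] w → u ≲[ n ] w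
  ≲-trans u≲v v≲w ∣s∣≤n = v≲w ∣s∣≤n ∘ u≲v ∣s∣≤n

  ∼-refl : ∀ {u : List A} {n} → u ∼[ n ] u
  ∼-refl = (λ _ → id) , (λ _ → id)

  ∼-sym : ∀ {u v : List A} {n} → u ∼[ n ] v → v ∼[ n ] u
  ∼-sym (u≲v , v≲u) = v≲u , u≲v

  ∼-trans : ∀ {u v w : List A} {n} → u ∼[ n ] v → v ∼[ n ] w → u ∼[ n ] w
  ∼-trans (u≲v , v≲u) (v≲w , w≲v) = ≲-trans u≲v v≲w , ≲-trans w≲v v≲u

  ≲-infix : ∀ x {u v : List A} z {n} → u ≲[ n ] v → x ++ u ++ z ≲[ n ] x ++ v ++ z
  ≲-infix x z u≲v ∣s∣≤n τ
    with s₁ , s₂ , refl , τ₁ , τ₂ ← ⊆-++⁻ x τ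
    with s₂₁ , s₂₂ , refl , τ₂₁ , τ₂₂ ← ⊆-++⁻ _ τ₂
    = ++⁺ τ₁ (++⁺ (u≲v (≤-trans (length-mono-≤ (++⁺ˡ s₁ (++⁺ʳ s₂₂ ⊆-refl))) ∣s∣≤n) τ₂₁) τ₂₂)

  ∼-infix : ∀ x {u v : List A} z {n} → u ∼[ n ] v → x ++ u ++ z ∼[ n ] x ++ v ++ z
  ∼-infix x z (u≲v , v≲u) = ≲-infix x z u≲v , ≲-infix x z v≲u

  ≲-reverse : ∀ {u v : List A} {n} → u ≲[ n ] v → reverse u ≲[ n ] reverse v
  ≲-reverse {v = v} u≲v {s} ∣s∣≤n τ =
    subst (_⊆ reverse v) (reverse-involutive s)
      (reverse⁺ (u≲v (subst (_≤ _) (sym (length-reverse s)) ∣s∣≤n) (⊆reverse⇒reverse⊆ τ)))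

  ∼-reverse : ∀ {u v : List A} {n} → u ∼[ n ] v → reverse u ∼[ n ] reverse v
  ∼-reverse (u≲v , v≲u) = ≲-reverse u≲v , ≲-reverse v≲u

  ⊆ₛ⇒≲^ : ∀ {w v : List A} {n} → w ⊆ₛ v → w ≲[ n ] v ^ n
  ⊆ₛ⇒≲^ w⊆v {s} ∣s∣≤n τ = ⊆-trans (⊆ₛ⇒⊆^ s (w⊆v ∘ lookup τ)) (^-mono ∣s∣≤n)

  pumpʳ : ∀ {t v : List A} n → t ⊆ₛ v → v ^ n ++ t ∼[ n ] v ^ n
  pumpʳ {t} {v} n t⊆v = ⊆ₛ⇒≲^ (Sum.[ ^-⊆ₛ v n , t⊆v ] ∘ ∈-++⁻ (v ^ n)) , ⊆⇒≲ (++⁺ʳ t ⊆-refl)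

  pumpˡ : ∀ {t v : List A} n → t ⊆ₛ v → t ++ v ^ n ∼[ n ] v ^ n
  pumpˡ {t} {v} n t⊆v = ⊆ₛ⇒≲^ (Sum.[ t⊆v , ^-⊆ₛ v n ] ∘ ∈-++⁻ t) , ⊆⇒≲ (++⁺ˡ t ⊆-refl)

  Superword : ℕ → List A → List A → Set
  Superword n u v = ∃[ w ] u ⊆ w × v ⊆ w × u ∼[ n ] w

  Superword-swap : ∀ {n} {u v : List A} → u ∼[ n ] v → Superword n u v → Superword n v u
  Superword-swap u∼v (w , u⊆w , v⊆w , u∼w) = w , v⊆w , u⊆w , ∼-trans (∼-sym u∼v) u∼w

  PiecewiseTestable : (List A → Bool) → Set
  PiecewiseTestable K = ∃[ n ] K Preserves _∼[ n ]_ ⟶ _≡_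

  PiecewiseTestable-reverse : ∀ {K K̂ : List A → Bool} → (∀ w → K̂ w ≡ K (reverse w)) →
                              PiecewiseTestable K → PiecewiseTestable K̂
  PiecewiseTestable-reverse K̂≡Kᴿ (n , invariant) =
    n , λ {u} {v} u∼v → trans (K̂≡Kᴿ u) (trans (invariant (∼-reverse u∼v)) (sym (K̂≡Kᴿ v)))

-- Saturation

module _ {A : Set} where

  -- Saturatedʳ n [ a ] p says that p ++ [ a ] ∼[ n ] p.
  Saturatedʳ Saturatedˡ : ℕ → List A → List A → Set
  Saturatedʳ n B w = ∀ {s} → length s < n → s ⊆ w → ∀ {b} → b ∈ B → s ++ [ b ] ⊆ w
  Saturatedˡ n B w = ∀ {s} → length s < n → s ⊆ w → ∀ {b} → b ∈ B → b ∷ s ⊆ w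

  Saturatedʳ-antitone : ∀ {m n} {B w : List A} → m ≤ n → Saturatedʳ n B w → Saturatedʳ m B w
  Saturatedʳ-antitone m≤n sat ∣s∣<m = sat (<-≤-trans ∣s∣<m m≤n)

  Saturatedˡ-antitone : ∀ {m n} {B w : List A} → m ≤ n → Saturatedˡ n B w → Saturatedˡ m B w
  Saturatedˡ-antitone m≤n sat ∣s∣<m = sat (<-≤-trans ∣s∣<m m≤n)

  Saturatedˡ⇒Saturatedʳ-reverse : ∀ {n} {B w : List A} → Saturatedˡ n B w → Saturatedʳ n B (reverse w)
  Saturatedˡ⇒Saturatedʳ-reverse {w = w} sat {s} ∣s∣<n τ {b} b∈B =
    subst (_⊆ reverse w) reverse-b∷sᴿ
      (reverse⁺ (sat (subst (_< _) (sym (length-reverse s)) ∣s∣<n) (⊆reverse⇒reverse⊆ τ) b∈B))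
    where
    reverse-b∷sᴿ : reverse (b ∷ reverse s) ≡ s ++ [ b ]
    reverse-b∷sᴿ = trans (unfold-reverse b (reverse s)) (cong (_++ [ b ]) (reverse-involutive s))

  Saturatedʳ⇒Saturatedˡ-reverse : ∀ {n} {B w : List A} → Saturatedʳ n B w → Saturatedˡ n B (reverse w)
  Saturatedʳ⇒Saturatedˡ-reverse {w = w} sat {s} ∣s∣<n τ {b} b∈B =
    subst (_⊆ reverse w) reverse-sᴿ∷b
      (reverse⁺ (sat (subst (_< _) (sym (length-reverse s)) ∣s∣<n) (⊆reverse⇒reverse⊆ τ) b∈B))
    where
    reverse-sᴿ∷b : reverse (reverse s ++ [ b ]) ≡ b ∷ s
    reverse-sᴿ∷b = trans (reverse-++ (reverse s) [ b ]) (cong (b ∷_) (reverse-involutive s))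

  Absorbingʳ Absorbingˡ : ℕ → (List A → Bool) → Set
  Absorbingʳ n K = ∀ p a q → Saturatedʳ n [ a ] p → K (p ++ a ∷ q) ≡ K (p ++ q)
  Absorbingˡ n K = ∀ p a q → Saturatedˡ n [ a ] q → K (p ++ a ∷ q) ≡ K (p ++ q)

  Absorbingʳ-mono : ∀ {m n K} → m ≤ n → Absorbingʳ m K → Absorbingʳ n K
  Absorbingʳ-mono m≤n abs p a q = abs p a q ∘ Saturatedʳ-antitone m≤n

  Absorbingˡ-mono : ∀ {m n K} → m ≤ n → Absorbingˡ m K → Absorbingˡ n K
  Absorbingˡ-mono m≤n abs p a q = abs p a q ∘ Saturatedˡ-antitone m≤n

  module _ {K K̂ : List A → Bool} (K̂≡Kᴿ : ∀ w → K̂ w ≡ K (reverse w)) where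

    deletion-reverse : ∀ p a q → K (reverse q ++ a ∷ reverse p) ≡ K (reverse q ++ reverse p) →
                       K̂ (p ++ a ∷ q) ≡ K̂ (p ++ q)
    deletion-reverse p a q K-deletion = begin
      K̂ (p ++ a ∷ q)                 ≡⟨ K̂≡Kᴿ _ ⟩
      K (reverse (p ++ a ∷ q))       ≡⟨ cong K (reverse-insert p a q) ⟩
      K (reverse q ++ a ∷ reverse p) ≡⟨ K-deletion ⟩
      K (reverse q ++ reverse p)     ≡⟨ cong K (reverse-++ p q) ⟨
      K (reverse (p ++ q))           ≡⟨ K̂≡Kᴿ _ ⟨
      K̂ (p ++ q)                     ∎
      where open ≡-Reasoning

    Absorbingʳ-reverse : ∀ {n} → Absorbingʳ n K → Absorbingˡ n K̂
    Absorbingʳ-reverse absʳ p a q sat =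
      deletion-reverse p a q (absʳ (reverse q) a (reverse p) (Saturatedˡ⇒Saturatedʳ-reverse sat))

    Absorbingˡ-reverse : ∀ {n} → Absorbingˡ n K → Absorbingʳ n K̂
    Absorbingˡ-reverse absˡ p a q sat =
      deletion-reverse p a q (absˡ (reverse q) a (reverse p) (Saturatedʳ⇒Saturatedˡ-reverse sat))

-- Loops along saturated words

module Factorisation {A : Set} (_≟_ : DecidableEquality A) where

  open import Data.List.Membership.DecPropositional _≟_ using (_∈?_)

  shortest-covering-suffix : ∀ {B x : List A} {b} → B ⊆ₛ x → b ∈ B →
                             ∃[ x′ ] ∃[ c ] ∃[ r ] x ≡ x′ ++ c ∷ r × c ∈ B × c ∉ r × B ⊆ₛ c ∷ r
  shortest-covering-suffix {x = []} B⊆x b∈B with () ← B⊆x b∈B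
  shortest-covering-suffix {B} {d ∷ x} B⊆dx b∈B with all-or-counterexample (_∈? x) B
  ... | inj₁ B⊆x with x′ , c , r , refl , covering ← shortest-covering-suffix (All.lookup B⊆x) b∈B
    = d ∷ x′ , c , r , refl , covering
  shortest-covering-suffix {B} {d ∷ x} B⊆dx b∈B | inj₂ (c , c∈B , c∉x) with B⊆dx c∈B
  ... | here refl = [] , c , x , refl , c∈B , c∉x , B⊆dx
  ... | there c∈x = ⊥-elim (c∉x c∈x)

  peel : ∀ {m} {B x : List A} {b} → Saturatedʳ (suc m) B x → b ∈ B →
         ∃₂ λ x′ r → x ≡ x′ ++ r × B ⊆ₛ r × Saturatedʳ m r x′
  peel {m} {x = x} sat b∈B
    with shortest-covering-suffix (λ b∈B → lookup (sat (s≤s z≤n) (minimum x) b∈B) (here refl)) b∈B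
  ... | x′ , c , r , refl , c∈B , c∉r , B⊆cr = x′ , c ∷ r , refl , B⊆cr , sat′
    where
    sat′ : Saturatedʳ m (c ∷ r) x′
    sat′ {s} ∣s∣<m s⊆x′ {e} e∈cr
      with ⊆-++-∷⁻ s x′ (subst (_⊆ x′ ++ c ∷ r) (∷ʳ-++ s e [ c ])
             (sat (s≤s (subst (_≤ m) (sym (length-snoc s e)) ∣s∣<m)) (++⁺ s⊆x′ (from∈ e∈cr)) c∈B))
    ... | inj₁ se⊆x′ = se⊆x′
    ... | inj₂ ec⊆cr = ⊥-elim (c∉r (lookup (∷⁻ ec⊆cr) (here refl)))

  -- Tower B m x : x = x₀ r_m ⋯ r₁, where B ⊆ₛ r₁ and r_i ⊆ₛ r_(i+1).
  data Tower : List A → ℕ → List A → Set where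
    []  : ∀ {B x} → Tower B zero x
    _◂_ : ∀ {B r m x} → Tower r m x → B ⊆ₛ r → Tower B (suc m) (x ++ r)

  tower : ∀ {m} {B x : List A} {b} → Saturatedʳ m B x → b ∈ B → Tower B m x
  tower {zero}  _   _   = []
  tower {suc m} sat b∈B with _ , _ , refl , B⊆r , sat′ ← peel sat b∈B = tower sat′ (B⊆r b∈B) ◂ B⊆r

  prefix suffix : ∀ {B m} {x : List A} → Tower B m x → Fin (suc m) → List A
  prefix {x = x}     _       zero    = x
  prefix             (t ◂ _) (suc i) = prefix t i
  suffix             _       zero    = []
  suffix (_◂_ {r = r} t _)   (suc i) = suffix t i ++ r

  prefix++suffix : ∀ {B m} {x : List A} (t : Tower B m x) i → prefix t i ++ suffix t i ≡ x
  prefix++suffix {x = x} _ zero = ++-identityʳ x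
  prefix++suffix (_◂_ {r = r} t _) (suc i) =
    trans (sym (++-assoc (prefix t i) (suffix t i) r)) (cong (_++ r) (prefix++suffix t i))

  cut-loop : ∀ {B m} {x : List A} (t : Tower B m x) {i j} → i <ᶠ j →
             ∃[ v ] prefix t i ≡ prefix t j ++ v × suffix t j ≡ v ++ suffix t i
                    × B ⊆ₛ v × suffix t i ⊆ₛ v
  cut-loop (_◂_ {r = r} t B⊆r) {zero} {suc j} _ =
    suffix t j ++ r , split , sym (++-identityʳ _) , ∈-++⁺ʳ (suffix t j) ∘ B⊆r , λ ()
    where
    split : _ ++ r ≡ prefix t j ++ suffix t j ++ r
    split = trans (cong (_++ r) (sym (prefix++suffix t j))) (++-assoc (prefix t j) (suffix t j) r)
  cut-loop (_◂_ {r = r} t B⊆r) {suc i} {suc j} (s≤s i<j) with v , eqᵖ , eqˢ , r⊆v , sᵢ⊆v ← cut-loop t i<j =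
    v , eqᵖ , trans (cong (_++ r) eqˢ) (++-assoc v (suffix t i) r) , r⊆v ∘ B⊆r ,
    Sum.[ sᵢ⊆v , r⊆v ] ∘ ∈-++⁻ (suffix t i)

  -- h sees both sides of a cut so that loopˡ can be obtained from loopʳ by reversal.
  record Loop {C : Set} (h : List A → List A → C) (x : List A) : Set where
    field
      left loop right : List A
      split  : x ≡ left ++ loop ++ right
      unseen : h left (loop ++ right) ≡ h (left ++ loop) right

  open Loop

  loopʳ : ∀ {N m} {B x : List A} {b} → N ≤ m → Saturatedʳ m B x → b ∈ B →
          (h : List A → List A → Fin N) → Σ[ ℓ ∈ Loop h x ] B ⊆ₛ loop ℓ × right ℓ ⊆ₛ loop ℓ
  loopʳ {m = m} {B} {x} N≤m sat b∈B h = fromTower (tower sat b∈B)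
    where
    fromTower : Tower B m x → Σ[ ℓ ∈ Loop h x ] B ⊆ₛ loop ℓ × right ℓ ⊆ₛ loop ℓ
    fromTower t with i , j , i<j , hᵢ≡hⱼ ← pigeonhole (s≤s N≤m) (λ i → h (prefix t i) (suffix t i))
                with v , eqᵖ , eqˢ , B⊆v , sᵢ⊆v ← cut-loop t i<j = ℓ , B⊆v , sᵢ⊆v
      where
      open ≡-Reasoning
      ℓ : Loop h x
      ℓ .left   = prefix t j
      ℓ .loop   = v
      ℓ .right  = suffix t i
      ℓ .split  = begin
        x                                ≡⟨ prefix++suffix t i ⟨
        prefix t i ++ suffix t i         ≡⟨ cong (_++ suffix t i) eqᵖ ⟩
        (prefix t j ++ v) ++ suffix t i  ≡⟨ ++-assoc (prefix t j) v (suffix t i) ⟩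
        prefix t j ++ v ++ suffix t i    ∎
      ℓ .unseen = begin
        h (prefix t j) (v ++ suffix t i) ≡⟨ cong (h (prefix t j)) eqˢ ⟨
        h (prefix t j) (suffix t j)      ≡⟨ hᵢ≡hⱼ ⟨
        h (prefix t i) (suffix t i)      ≡⟨ cong (λ p → h p (suffix t i)) eqᵖ ⟩
        h (prefix t j ++ v) (suffix t i) ∎

  loopˡ : ∀ {N m} {B x : List A} {b} → N ≤ m → Saturatedˡ m B x → b ∈ B →
          (h : List A → List A → Fin N) → Σ[ ℓ ∈ Loop h x ] B ⊆ₛ loop ℓ × left ℓ ⊆ₛ loop ℓ
  loopˡ {x = x} N≤m sat b∈B h
    with ℓʳ , B⊆v , r⊆v ← loopʳ N≤m (Saturatedˡ⇒Saturatedʳ-reverse sat) b∈B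
                                (λ p q → h (reverse q) (reverse p))
    = ℓ , Any.reverse⁺ ∘ B⊆v , Any.reverse⁺ ∘ r⊆v ∘ Any.reverse⁻
    where
    open ≡-Reasoning
    open Loop ℓʳ renaming (left to P; loop to V; right to R)
    ℓ : Loop h x
    ℓ .left   = reverse R
    ℓ .loop   = reverse V
    ℓ .right  = reverse P
    ℓ .split  = begin
      x                                     ≡⟨ reverse-involutive x ⟨
      reverse (reverse x)                   ≡⟨ cong reverse (split ℓʳ) ⟩
      reverse (P ++ V ++ R)                 ≡⟨ reverse-++ P (V ++ R) ⟩
      reverse (V ++ R) ++ reverse P         ≡⟨ cong (_++ reverse P) (reverse-++ V R) ⟩
      (reverse R ++ reverse V) ++ reverse P ≡⟨ ++-assoc (reverse R) (reverse V) (reverse P) ⟩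
      reverse R ++ reverse V ++ reverse P   ∎
    ℓ .unseen = begin
      h (reverse R) (reverse V ++ reverse P) ≡⟨ cong (h (reverse R)) (reverse-++ P V) ⟨
      h (reverse R) (reverse (P ++ V))       ≡⟨ unseen ℓʳ ⟨
      h (reverse (V ++ R)) (reverse P)       ≡⟨ cong (λ p → h p (reverse P)) (reverse-++ V R) ⟩
      h (reverse R ++ reverse V) (reverse P) ∎

-- Simon's lemma

module _ {A : Set} where

  Obstruction : A → A → List A → Set
  Obstruction a b t = ∃[ β ] β ⊆ t × ¬ β ++ [ b ] ⊆ t × Saturatedʳ (length β) [ a ] t

  -- A subword of t a b v that uses the a either has a short enough prefix for a to be
  -- absorbed into t, or continues with a suffix of u, hence lies in t a u ∼ t b v.
  insertion : ∀ {n} {a b : A} {t u v} → a ≢ b → t ++ a ∷ u ∼[ n ] t ++ b ∷ v → Obstruction a b t →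
              t ++ a ∷ b ∷ v ∼[ n ] t ++ b ∷ v
  insertion {n} {a} {b} {t} {u} {v} a≢b (tau≲tbv , tbv≲tau) (β , β⊆t , ¬βb⊆t , sat) =
    delete-a , ⊆⇒≲ (++⁺ ⊆-refl (a ∷ʳ ⊆-refl))
    where
    b∷⊆u : ∀ {w} → length (β ++ b ∷ w) ≤ n → w ⊆ v → b ∷ w ⊆ u
    b∷⊆u ∣βbw∣≤n w⊆v with ⊆-++-∷⁻ β t (tbv≲tau ∣βbw∣≤n (++⁺ β⊆t (refl ∷ w⊆v)))
    ... | inj₁ βb⊆t         = ⊥-elim (¬βb⊆t βb⊆t)
    ... | inj₂ (.a ∷ʳ bw⊆u) = bw⊆u
    ... | inj₂ (b≡a ∷ _)    = ⊥-elim (a≢b (sym b≡a))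
    delete-a : t ++ a ∷ b ∷ v ≲[ n ] t ++ b ∷ v
    delete-a ∣s∣≤n s⊆ with ⊆-insert⁻ t s⊆
    ... | inj₁ s⊆tbv = s⊆tbv
    ... | inj₂ (α , γ , refl , α⊆t , γ⊆bv) with length β ≤? length α
    ...   | no ∣β∣≰∣α∣ =
            subst (_⊆ t ++ b ∷ v) (∷ʳ-++ α a γ) (++⁺ (sat (≰⇒> ∣β∣≰∣α∣) α⊆t (here refl)) γ⊆bv)
    ...   | yes ∣β∣≤∣α∣ = tau≲tbv ∣s∣≤n (++⁺ α⊆t (refl ∷ γ⊆u γ⊆bv))
      where
      shorter : ∀ {w} → length w ≤ length γ → length (β ++ b ∷ w) ≤ n
      shorter {w} ∣w∣≤∣γ∣ = let open ≤-Reasoning in begin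
        length (β ++ b ∷ w)       ≡⟨ length-++ β ⟩
        length β + suc (length w) ≤⟨ +-mono-≤ ∣β∣≤∣α∣ (s≤s ∣w∣≤∣γ∣) ⟩
        length α + suc (length γ) ≡⟨ length-++ α ⟨
        length (α ++ a ∷ γ)       ≤⟨ ∣s∣≤n ⟩
        n                         ∎
      γ⊆u : γ ⊆ b ∷ v → γ ⊆ u
      γ⊆u (.b ∷ʳ γ⊆v)  = ∷ˡ⁻ (b∷⊆u (shorter ≤-refl) γ⊆v)
      γ⊆u (refl ∷ γ⊆v) = b∷⊆u (shorter (n≤1+n _)) γ⊆v

  superword-via-insertion : ∀ {n} {a b : A} {t u v} → a ≢ b → t ++ a ∷ u ∼[ n ] t ++ b ∷ v →
                            Obstruction a b t →
                            (t ++ a ∷ u ∼[ n ] t ++ a ∷ b ∷ v → Superword n (t ++ a ∷ u) (t ++ a ∷ b ∷ v)) →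
                            Superword n (t ++ a ∷ u) (t ++ b ∷ v)
  superword-via-insertion {a = a} a≢b tau∼tbv o superword
    with w , tau⊆w , tabv⊆w , tau∼w ← superword (∼-trans tau∼tbv (∼-sym (insertion a≢b tau∼tbv o)))
    = w , tau⊆w , ⊆-trans (++⁺ ⊆-refl (a ∷ʳ ⊆-refl)) tabv⊆w , tau∼w

boundary : ∀ {P : ℕ → Set} → Decidable P → P 0 → ∀ n → ¬ P n → ∃[ m ] P m × ¬ P (suc m)
boundary P? P0 zero    ¬P0  = ⊥-elim (¬P0 P0)
boundary P? P0 (suc n) ¬Psn with P? n
... | yes Pn = n , Pn , ¬Psn
... | no ¬Pn = boundary P? P0 n ¬Pn

module _ {k : ℕ} where

  open import Data.List.Relation.Binary.Sublist.DecPropositional {A = Fin k} _≟ᶠ_ using (_⊆?_)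

  words< : ℕ → List (Word k)
  words< zero    = []
  words< (suc n) = [] ∷ cartesianProductWith _∷_ (allFin k) (words< n)

  ∈-words< : ∀ {n} (s : Word k) → length s < n → s ∈ words< n
  ∈-words< {suc n} []      _           = here refl
  ∈-words< {suc n} (c ∷ s) (s≤s ∣s∣<n) =
    there (∈-cartesianProductWith⁺ _∷_ (∈-allFin c) (∈-words< s ∣s∣<n))

  words<-length : ∀ {n} {s : Word k} → s ∈ words< n → length s < n
  words<-length {suc n} (here refl) = s≤s z≤n
  words<-length {suc n} (there s∈)
    with _ , _ , _ , s′∈ , refl ← ∈-cartesianProductWith⁻ _∷_ (allFin k) (words< n) s∈
    = s≤s (words<-length s′∈)

  bounded-or-counterexample : ∀ {P : Word k → Set} → Decidable P → ∀ n →
                              (∀ {s} → length s < n → P s) ⊎ ∃[ s ] length s < n × ¬ P s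
  bounded-or-counterexample P? n with all-or-counterexample P? (words< n)
  ... | inj₁ all             = inj₁ λ {s} ∣s∣<n → All.lookup all (∈-words< s ∣s∣<n)
  ... | inj₂ (s , s∈ , ¬Ps) = inj₂ (s , words<-length s∈ , ¬Ps)

  extensible-or-counterexample : ∀ n (f : Word k → Word k) t →
                                 (∀ {s} → length s < n → s ⊆ t → f s ⊆ t)
                                 ⊎ ∃[ s ] length s < n × s ⊆ t × ¬ f s ⊆ t
  extensible-or-counterexample n f t with bounded-or-counterexample (λ s → s ⊆? t →-dec f s ⊆? t) n
  ... | inj₁ extensible             = inj₁ extensible
  ... | inj₂ (s , ∣s∣<n , ¬extends) with s ⊆? t
  ...   | yes s⊆t = inj₂ (s , ∣s∣<n , s⊆t , ¬extends ∘ const)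
  ...   | no  s⊈t = ⊥-elim (¬extends (⊥-elim ∘ s⊈t))

  saturatedʳ-or-counterexample : ∀ n a (t : Word k) →
                                 Saturatedʳ n [ a ] t ⊎ ∃[ s ] length s < n × s ⊆ t × ¬ s ++ [ a ] ⊆ t
  saturatedʳ-or-counterexample n a t =
    Sum.map₁ (λ ext ∣s∣<n s⊆t → λ { (here refl) → ext ∣s∣<n s⊆t })
             (extensible-or-counterexample n (_++ [ a ]) t)

  saturatedˡ-or-counterexample : ∀ n a (t : Word k) →
                                 Saturatedˡ n [ a ] t ⊎ ∃[ s ] length s < n × s ⊆ t × ¬ a ∷ s ⊆ t
  saturatedˡ-or-counterexample n a t =
    Sum.map₁ (λ ext ∣s∣<n s⊆t → λ { (here refl) → ext ∣s∣<n s⊆t })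
             (extensible-or-counterexample n (a ∷_) t)

  saturatedʳ? : ∀ n a (t : Word k) → Dec (Saturatedʳ n [ a ] t)
  saturatedʳ? n a t with saturatedʳ-or-counterexample n a t
  ... | inj₁ sat                        = yes sat
  ... | inj₂ (_ , ∣s∣<n , s⊆t , ¬sa⊆t) = no λ sat → ¬sa⊆t (sat ∣s∣<n s⊆t (here refl))

  shortest-unextensible : ∀ a (t : Word k) → Obstruction a a t
  shortest-unextensible a t
    with m , sat , ¬sat ← boundary (λ m → saturatedʳ? m a t) (λ ()) (suc (length t))
                                   (λ sat → snoc⊈ t (sat ≤-refl ⊆-refl (here refl)))
    with saturatedʳ-or-counterexample (suc m) a t
  ... | inj₁ sat′                           = ⊥-elim (¬sat sat′)
  ... | inj₂ (β , s≤s ∣β∣≤m , β⊆t , ¬βa⊆t) = β , β⊆t , ¬βa⊆t , Saturatedʳ-antitone ∣β∣≤m sat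

  obstruction : ∀ a b (t : Word k) → Obstruction a b t ⊎ Obstruction b a t
  obstruction a b t with shortest-unextensible a t | shortest-unextensible b t
  ... | α , α⊆t , ¬αa⊆t , satα | β , β⊆t , ¬βb⊆t , satβ with length β ≤? length α
  ...   | yes ∣β∣≤∣α∣ = inj₁ (β , β⊆t , ¬βb⊆t , Saturatedʳ-antitone ∣β∣≤∣α∣ satα)
  ...   | no  ∣β∣≰∣α∣ = inj₂ (α , α⊆t , ¬αa⊆t , Saturatedʳ-antitone (<⇒≤ (≰⇒> ∣β∣≰∣α∣)) satβ)

  -- The size argument is fuel: the symmetric case swaps u and v.
  ∼⇒superword : ∀ {n} {u v : Word k} → u ∼[ n ] v → Superword n u v
  ∼⇒superword {n} {u} {v} = superword _ [] u v ≤-refl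
    where
    superword : ∀ size (t u v : Word k) → length u + length v ≤ size → t ++ u ∼[ n ] t ++ v →
                Superword n (t ++ u) (t ++ v)
    superword-after : ∀ size (t : Word k) a u v → length u + length v ≤ size →
                      t ++ a ∷ u ∼[ n ] t ++ a ∷ v → Superword n (t ++ a ∷ u) (t ++ a ∷ v)
    superword-after size t a u v ≤size ta∼ =
      subst₂ (Superword n) (∷ʳ-++ t a u) (∷ʳ-++ t a v)
        (superword size (t ++ [ a ]) u v ≤size (subst₂ _∼[ n ]_ (sym (∷ʳ-++ t a u)) (sym (∷ʳ-++ t a v)) ta∼))
    superword _ t []      []      _ _  = t ++ [] , ⊆-refl , ⊆-refl , ∼-refl
    superword _ t []      (c ∷ v) _ t∼ = t ++ c ∷ v , ++⁺ ⊆-refl (minimum _) , ⊆-refl , t∼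
    superword _ t (c ∷ u) []      _ _  = t ++ c ∷ u , ⊆-refl , ++⁺ ⊆-refl (minimum _) , ∼-refl
    superword (suc size) t (a ∷ u) (b ∷ v) (s≤s ≤size) t∼ with a ≟ᶠ b
    ... | yes refl = superword-after size t a u v (≤-trans (+-monoʳ-≤ (length u) (n≤1+n _)) ≤size) t∼
    ... | no  a≢b with obstruction a b t
    ...   | inj₁ o = superword-via-insertion a≢b t∼ o (superword-after size t a u (b ∷ v) ≤size)
    ...   | inj₂ o = Superword-swap (∼-sym t∼)
                       (superword-via-insertion (a≢b ∘ sym) (∼-sym t∼) o
                         (superword-after size t b v (a ∷ u) (≤-trans (≤-reflexive swapped) ≤size)))
      where
      swapped : length v + suc (length u) ≡ length u + suc (length v)
      swapped = trans (+-comm (length v) (suc (length u))) (sym (+-suc (length u) (length v)))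

  deletable⇒saturated : ∀ {n} p {a : Fin k} q → p ++ a ∷ q ≲[ n + n ] p ++ q →
                        Saturatedʳ n [ a ] p ⊎ Saturatedˡ n [ a ] q
  deletable⇒saturated {n} p {a} q paq≲pq
    with saturatedʳ-or-counterexample n a p | saturatedˡ-or-counterexample n a q
  ... | inj₁ satʳ | _         = inj₁ satʳ
  ... | inj₂ _    | inj₁ satˡ = inj₂ satˡ
  ... | inj₂ (s , ∣s∣<n , s⊆p , ¬sa⊆p) | inj₂ (r , ∣r∣<n , r⊆q , ¬ar⊆q) =
    ⊥-elim (Sum.[ ¬sa⊆p , ¬ar⊆q ] (⊆-++-∷⁻ s p (paq≲pq ∣sar∣≤2n (++⁺ s⊆p (refl ∷ r⊆q)))))
    where
    ∣sar∣≤2n : length (s ++ a ∷ r) ≤ n + n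
    ∣sar∣≤2n = subst (_≤ n + n) (sym (length-++ s)) (+-mono-≤ (<⇒≤ ∣s∣<n) ∣r∣<n)

  module _ {n} {K : Word k → Bool} (absʳ : Absorbingʳ n K) (absˡ : Absorbingˡ n K) where

    absorbing⇒deletable : ∀ p a q → p ++ a ∷ q ≲[ n + n ] p ++ q → K (p ++ a ∷ q) ≡ K (p ++ q)
    absorbing⇒deletable p a q = Sum.[ absʳ p a q , absˡ p a q ] ∘ deletable⇒saturated p q

    absorbing⇒⊆-invariant : ∀ {u w} → u ⊆ w → u ∼[ n + n ] w → K u ≡ K w
    absorbing⇒⊆-invariant = invariant []
      where
      invariant : ∀ t {u w} → u ⊆ w → t ++ u ∼[ n + n ] t ++ w → K (t ++ u) ≡ K (t ++ w)
      invariant t []         _ = refl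
      invariant t {u} {c ∷ w} (.c ∷ʳ u⊆w) (tu≲tcw , tcw≲tu) =
        trans (invariant t u⊆w (⊆⇒≲ tu⊆tw , ≲-trans (⊆⇒≲ (++⁺ ⊆-refl (c ∷ʳ ⊆-refl))) tcw≲tu))
              (sym (absorbing⇒deletable t c w (≲-trans tcw≲tu (⊆⇒≲ tu⊆tw))))
        where
        tu⊆tw : t ++ u ⊆ t ++ w
        tu⊆tw = ++⁺ ⊆-refl u⊆w
      invariant t {c ∷ u} {.c ∷ w} (refl ∷ u⊆w) tcu∼tcw =
        subst₂ (λ x y → K x ≡ K y) (∷ʳ-++ t c u) (∷ʳ-++ t c w)
          (invariant (t ++ [ c ]) u⊆w (subst₂ _∼[ n + n ]_ (sym (∷ʳ-++ t c u)) (sym (∷ʳ-++ t c w)) tcu∼tcw))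

    absorbing⇒invariant : K Preserves _∼[ n + n ]_ ⟶ _≡_
    absorbing⇒invariant u∼v with _ , u⊆w , v⊆w , u∼w ← ∼⇒superword u∼v =
      trans (absorbing⇒⊆-invariant u⊆w u∼w) (sym (absorbing⇒⊆-invariant v⊆w (∼-trans (∼-sym u∼v) u∼w)))

-- Boolean combinations of shuffle ideals

module _ {k : ℕ} where

  open import Data.List.Relation.Binary.Sublist.DecPropositional {A = Fin k} _≟ᶠ_ using (_⊆?_)
  open Equivalence
  open UpperBound using (theUpperBound; sub) renaming (inj₁ to ⊆ub₁; inj₂ to ⊆ub₂)

  ⋀ ⋁ : List (BExp k) → BExp k
  ⋀ []       = compᵇ (atom [])
  ⋀ (e ∷ es) = e ∩ᵇ ⋀ es
  ⋁ []       = atom []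
  ⋁ (e ∷ es) = e ∪ᵇ ⋁ es

  ⟦⋀⟧ : ∀ es {w} → ⟦ ⋀ es ⟧ w ⇔ All (λ e → ⟦ e ⟧ w) es
  ⟦⋀⟧ []       = mk⇔ (const All.[]) (const λ ())
  ⟦⋀⟧ (e ∷ es) = mk⇔ (λ (h , hs) → h All.∷ to (⟦⋀⟧ es) hs) λ { (h All.∷ hs) → h , from (⟦⋀⟧ es) hs }

  ⟦⋁⟧ : ∀ es {w} → ⟦ ⋁ es ⟧ w ⇔ Any (λ e → ⟦ e ⟧ w) es
  ⟦⋁⟧ []       = mk⇔ (λ ()) (λ ())
  ⟦⋁⟧ (e ∷ es) = mk⇔ Sum.[ here , there ∘ to (⟦⋁⟧ es) ]
                     λ { (here h) → inj₁ h ; (there hs) → inj₂ (from (⟦⋁⟧ es) hs) }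

  literal : Word k → Word k → BExp k
  literal r s with s ⊆? r
  ... | yes _ = atom [ s ]
  ... | no  _ = compᵇ (atom [ s ])

  ⟦literal⟧ : ∀ r s {w} → ⟦ literal r s ⟧ w ⇔ (s ⊆ r ⇔ s ⊆ w)
  ⟦literal⟧ r s with s ⊆? r
  ... | yes s⊆r = mk⇔ (λ { (here s⊆w) → mk⇔ (const s⊆w) (const s⊆r) ; (there ()) })
                      (λ r⇔w → here (to r⇔w s⊆r))
  ... | no  s⊈r = mk⇔ (λ s⊈w → mk⇔ (⊥-elim ∘ s⊈r) (⊥-elim ∘ s⊈w ∘ here))
                      (λ { r⇔w (here s⊆w) → s⊈r (from r⇔w s⊆w) ; _ (there ()) })

  ∼-class : ℕ → Word k → BExp k
  ∼-class n r = ⋀ (map (literal r) (words< (suc n)))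

  ⟦∼-class⟧ : ∀ n r {w} → ⟦ ∼-class n r ⟧ w ⇔ r ∼[ n ] w
  ⟦∼-class⟧ n r {w} = mk⇔ (literals⇒∼ ∘ All.map⁻ ∘ to (⟦⋀⟧ _))
                          (from (⟦⋀⟧ _) ∘ All.map⁺ ∘ All.tabulate ∘ literal-holds)
    where
    literals⇒∼ : All (λ s → ⟦ literal r s ⟧ w) (words< (suc n)) → r ∼[ n ] w
    literals⇒∼ literals = (λ ∣s∣≤n → to (agree ∣s∣≤n)) , (λ ∣s∣≤n → from (agree ∣s∣≤n))
      where
      agree : ∀ {s} → length s ≤ n → s ⊆ r ⇔ s ⊆ w
      agree {s} ∣s∣≤n = to (⟦literal⟧ r s) (All.lookup literals (∈-words< s (s≤s ∣s∣≤n)))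
    literal-holds : r ∼[ n ] w → ∀ {s} → s ∈ words< (suc n) → ⟦ literal r s ⟧ w
    literal-holds (r≲w , w≲r) s∈ with s≤s ∣s∣≤n ← words<-length s∈ =
      from (⟦literal⟧ r _) (mk⇔ (r≲w ∣s∣≤n) (w≲r ∣s∣≤n))

  cover : ∀ (w : Word k) S → ∃[ r ] r ⊆ w × (∀ {s} → s ∈ S → s ⊆ w → s ⊆ r) × length r ≤ sum (map length S)
  cover w []      = [] , minimum w , (λ ()) , z≤n
  cover w (s ∷ S) with r , r⊆w , covers , ∣r∣≤ ← cover w S | s ⊆? w
  ... | no  s⊈w = r , r⊆w , (λ { (here refl) → ⊥-elim ∘ s⊈w ; (there s∈S) → covers s∈S }) ,
                  ≤-trans ∣r∣≤ (m≤n+m _ _)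
  ... | yes s⊆w = theUpperBound ub , sub ub ,
                  (λ { (here refl) _ → ⊆ub₁ ub ; (there s∈S) s′⊆w → ⊆-trans (covers s∈S s′⊆w) (⊆ub₂ ub) }) ,
                  ≤-trans (upper-bound-length s⊆w r⊆w) (+-monoʳ-≤ (length s) ∣r∣≤)
    where
    ub : UpperBound s⊆w r⊆w
    ub = ⊆-upper-bound s⊆w r⊆w

  representativeBound : ℕ → ℕ
  representativeBound n = sum (map length (words< {k} (suc n)))

  representative : ∀ n (w : Word k) → ∃[ r ] r ∈ words< (suc (representativeBound n)) × r ∼[ n ] w
  representative n w with r , r⊆w , covers , ∣r∣≤ ← cover w (words< (suc n)) =
    r , ∈-words< r (s≤s ∣r∣≤) , ⊆⇒≲ r⊆w , λ ∣s∣≤n → covers (∈-words< _ (s≤s ∣s∣≤n))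

  depth : BExp k → ℕ
  depth (atom us) = sum (map length us)
  depth (e ∪ᵇ f)  = depth e ⊔ depth f
  depth (e ∩ᵇ f)  = depth e ⊔ depth f
  depth (compᵇ e) = depth e

  Union½-invariant : ∀ (us : List (Word k)) {n u v} → sum (map length us) ≤ n → u ≲[ n ] v →
                     Union½ us u → Union½ us v
  Union½-invariant (s ∷ us) ∑≤n u≲v (here s⊆u) = here (u≲v (≤-trans (m≤m+n _ _) ∑≤n) s⊆u)
  Union½-invariant (s ∷ us) ∑≤n u≲v (there s∈) = there (Union½-invariant us (≤-trans (m≤n+m _ _) ∑≤n) u≲v s∈)

  ⟦⟧-invariant : ∀ e {n u v} → depth e ≤ n → u ∼[ n ] v → ⟦ e ⟧ u → ⟦ e ⟧ v
  ⟦⟧-invariant (atom us) d≤n (u≲v , _) = Union½-invariant us d≤n u≲v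
  ⟦⟧-invariant (e ∪ᵇ f)  d≤n u∼v =
    Sum.map (⟦⟧-invariant e (m⊔n≤o⇒m≤o _ _ d≤n) u∼v) (⟦⟧-invariant f (m⊔n≤o⇒n≤o _ _ d≤n) u∼v)
  ⟦⟧-invariant (e ∩ᵇ f)  d≤n u∼v =
    Product.map (⟦⟧-invariant e (m⊔n≤o⇒m≤o _ _ d≤n) u∼v) (⟦⟧-invariant f (m⊔n≤o⇒n≤o _ _ d≤n) u∼v)
  ⟦⟧-invariant (compᵇ e) d≤n u∼v ¬eu ev = ¬eu (⟦⟧-invariant e d≤n (∼-sym u∼v) ev)

  InL1⇔piecewiseTestable : ∀ {K : Word k → Bool} → InL1 (λ w → K w ≡ true) ⇔ PiecewiseTestable K
  InL1⇔piecewiseTestable {K} = mk⇔ InL1⇒piecewiseTestable piecewiseTestable⇒InL1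
    where
    InL1⇒piecewiseTestable : InL1 (λ w → K w ≡ true) → PiecewiseTestable K
    InL1⇒piecewiseTestable (e , K≡e) =
      depth e , λ {u} {v} u∼v → ⇔→≡ (mk⇔ (from (K≡e v) ∘ ⟦⟧-invariant e ≤-refl u∼v ∘ to (K≡e u))
                                          (from (K≡e u) ∘ ⟦⟧-invariant e ≤-refl (∼-sym u∼v) ∘ to (K≡e v)))
    piecewiseTestable⇒InL1 : PiecewiseTestable K → InL1 (λ w → K w ≡ true)
    piecewiseTestable⇒InL1 (n , invariant) =
      ⋁ (map (∼-class n) accepted) , λ w → mk⇔ (expressed w) (accepted-class w)
      where
      accepting? : Decidable (λ r → K r ≡ true)
      accepting? r = K r ≟ᵇ true
      accepted : List (Word k)
      accepted = filter accepting? (words< (suc (representativeBound n)))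
      expressed : ∀ w → K w ≡ true → ⟦ ⋁ (map (∼-class n) accepted) ⟧ w
      expressed w Kw with r , r∈ , r∼w ← representative n w =
        from (⟦⋁⟧ _) (Any.map⁺ (lose (∈-filter⁺ accepting? r∈ (trans (invariant r∼w) Kw))
                                     (from (⟦∼-class⟧ n r) r∼w)))
      accepted-class : ∀ w → ⟦ ⋁ (map (∼-class n) accepted) ⟧ w → K w ≡ true
      accepted-class w e
        with r , r∈ , r∼w ← find (Any.map⁻ (to (⟦⋁⟧ _) e))
        with _ , Kr ← ∈-filter⁻ accepting? r∈ =
        trans (sym (invariant (to (⟦∼-class⟧ n r) r∼w))) Kr

-- Automata

module _ {k : ℕ} (F : DFA k) where

  accepts : Word k → Bool
  accepts w = final F (δ* F (s₀ F) w)

  δ*-++ : ∀ s u w → δ* F s (u ++ w) ≡ δ* F (δ* F s u) w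
  δ*-++ s []      w = refl
  δ*-++ s (a ∷ u) w = δ*-++ (δ F s a) u w

  via : ∀ u {s t w r} → δ* F s u ≡ t → δ* F t w ≡ r → δ* F s (u ++ w) ≡ r
  via u {s} {w = w} refl t→r = trans (δ*-++ s u w) t→r

  δ*-^ : ∀ {s} v n → δ* F s v ≡ s → δ* F s (v ^ n) ≡ s
  δ*-^ v zero    _    = refl
  δ*-^ v (suc n) loop = via v loop (δ*-^ v n loop)

  run : ∀ {s t} x u {z} → δ* F (s₀ F) x ≡ s → δ* F s u ≡ t → accepts (x ++ u ++ z) ≡ final F (δ* F t z)
  run x u x→s u→t = cong (final F) (via x x→s (via u u→t refl))

  ¬Sep⇒≡ : ∀ {s s′} z → ¬ Sep F s s′ z → final F (δ* F s z) ≡ final F (δ* F s′ z)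
  ¬Sep⇒≡ z ¬sep = decidable-stable (_ ≟ᵇ _) ¬sep

  piecewiseTestable⇒¬P₁ : PiecewiseTestable accepts → ¬ P₁ F
  piecewiseTestable⇒¬P₁ (n , invariant)
    (v , x , y , z , a , s₁ , s₂ , s₃ , ya⊆v , x→s₁ , v-loop , y→s₂ , a→s₃ , sep) =
    sep (begin
      final F (δ* F s₂ z)                       ≡⟨ run x (v ^ n ++ y) x→s₁ vⁿy→s₂ ⟨
      accepts (x ++ (v ^ n ++ y) ++ z)          ≡⟨ invariant (∼-infix x z pumped) ⟩
      accepts (x ++ (v ^ n ++ y ++ [ a ]) ++ z) ≡⟨ run x (v ^ n ++ y ++ [ a ]) x→s₁ vⁿya→s₃ ⟩
      final F (δ* F s₃ z)                       ∎)
    where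
    open ≡-Reasoning
    vⁿy→s₂ : δ* F s₁ (v ^ n ++ y) ≡ s₂
    vⁿy→s₂ = via (v ^ n) (δ*-^ v n v-loop) y→s₂
    vⁿya→s₃ : δ* F s₁ (v ^ n ++ y ++ [ a ]) ≡ s₃
    vⁿya→s₃ = via (v ^ n) (δ*-^ v n v-loop) (via y y→s₂ a→s₃)
    ya⊆ₛv : y ++ [ a ] ⊆ₛ v
    ya⊆ₛv = lookup ya⊆v
    pumped : v ^ n ++ y ∼[ n ] v ^ n ++ y ++ [ a ]
    pumped = ∼-trans (pumpʳ n (ya⊆ₛv ∘ ∈-++⁺ˡ)) (∼-sym (pumpʳ n ya⊆ₛv))

  piecewiseTestable⇒¬P₂ : PiecewiseTestable accepts → ¬ P₂ F
  piecewiseTestable⇒¬P₂ (n , invariant)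
    (u , x , z , z′ , a , s₁ , _ , s₃ , s₄ , az⊆u , x→s₁ , refl , z→s₃ , u-loop₃ , z→s₄ , u-loop₄ , sep) =
    sep (begin
      final F (δ* F s₃ z′)                  ≡⟨ run x (z ++ u ^ n) x→s₁ zuⁿ→s₃ ⟨
      accepts (x ++ (z ++ u ^ n) ++ z′)     ≡⟨ invariant (∼-infix x z′ pumped) ⟩
      accepts (x ++ (a ∷ z ++ u ^ n) ++ z′) ≡⟨ run x (a ∷ z ++ u ^ n) x→s₁ azuⁿ→s₄ ⟩
      final F (δ* F s₄ z′)                  ∎)
    where
    open ≡-Reasoning
    zuⁿ→s₃ : δ* F s₁ (z ++ u ^ n) ≡ s₃
    zuⁿ→s₃ = via z z→s₃ (δ*-^ u n u-loop₃)
    azuⁿ→s₄ : δ* F s₁ (a ∷ z ++ u ^ n) ≡ s₄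
    azuⁿ→s₄ = via z z→s₄ (δ*-^ u n u-loop₄)
    az⊆ₛu : a ∷ z ⊆ₛ u
    az⊆ₛu = lookup az⊆u
    pumped : z ++ u ^ n ∼[ n ] a ∷ z ++ u ^ n
    pumped = ∼-trans (pumpˡ n (az⊆ₛu ∘ there)) (∼-sym (pumpˡ n az⊆ₛu))

  P₁⇒P₃ : P₁ F → P₃ F
  P₁⇒P₃ (v , x , y , z , a , s₁ , s₂ , s₃ , ya⊆v , x→s₁ , v-loop , y→s₂ , a→s₃ , sep) =
    [] , v , x , y , z , [] , a , s₁ , s₂ , s₃ , δ* F s₂ z , δ* F s₃ z ,
    inj₁ ya⊆v , x→s₁ , v-loop , y→s₂ , a→s₃ , refl , refl , refl , refl , sep

  P₂⇒P₃ : P₂ F → P₃ F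
  P₂⇒P₃ (u , x , z , z′ , a , s₁ , s₂ , s₃ , s₄ ,
         az⊆u , x→s₁ , a→s₂ , z→s₃ , u-loop₃ , z→s₄ , u-loop₄ , sep) =
    u , [] , x , [] , z , z′ , a , s₁ , s₁ , s₂ , s₃ , s₄ ,
    inj₂ az⊆u , x→s₁ , refl , refl , a→s₂ , z→s₃ , u-loop₃ , z→s₄ , u-loop₄ , sep

  P₃⇒P₁⊎P₂ : P₃ F → P₁ F ⊎ P₂ F
  P₃⇒P₁⊎P₂ (u , v , x , y , z , z′ , a , s₁ , s₂ , s₃ , s₄ , s₅ ,
            inj₁ ya⊆v , x→s₁ , v-loop , y→s₂ , a→s₃ , z→s₄ , _ , z→s₅ , _ , sep) =
    inj₁ (v , x , y , z ++ z′ , a , s₁ , s₂ , s₃ , ya⊆v , x→s₁ , v-loop , y→s₂ , a→s₃ ,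
          λ eq → sep (begin
            final F (δ* F s₄ z′)        ≡⟨ cong (final F) (via z z→s₄ refl) ⟨
            final F (δ* F s₂ (z ++ z′)) ≡⟨ eq ⟩
            final F (δ* F s₃ (z ++ z′)) ≡⟨ cong (final F) (via z z→s₅ refl) ⟩
            final F (δ* F s₅ z′)        ∎))
    where open ≡-Reasoning
  P₃⇒P₁⊎P₂ (u , v , x , y , z , z′ , a , s₁ , s₂ , s₃ , s₄ , s₅ ,
            inj₂ az⊆u , x→s₁ , _ , y→s₂ , a→s₃ , z→s₄ , u-loop₄ , z→s₅ , u-loop₅ , sep) =
    inj₂ (u , x ++ y , z , z′ , a , s₂ , s₃ , s₄ , s₅ ,
          az⊆u , via x x→s₁ y→s₂ , a→s₃ , z→s₄ , u-loop₄ , z→s₅ , u-loop₅ , sep)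

  open Factorisation {Fin k} _≟ᶠ_ using (loopʳ; loopˡ)

  ¬P₁⇒absorbingʳ : ¬ P₁ F → Absorbingʳ (nStates F) accepts
  ¬P₁⇒absorbingʳ ¬p₁ p a q sat
    with record { left = x ; loop = v ; right = y ; split = refl ; unseen = unseen } , a∈v , y⊆v
           ← loopʳ ≤-refl sat (here refl) (λ pre _ → δ* F (s₀ F) pre) = begin
      accepts ((x ++ v ++ y) ++ a ∷ q)  ≡⟨ run (x ++ v ++ y) [ a ] reach-s₂ refl ⟩
      final F (δ* F s₃ q)               ≡⟨ ¬Sep⇒≡ q (λ sep → ¬p₁ (P₁-witness sep)) ⟨
      final F (δ* F s₂ q)               ≡⟨ run (x ++ v ++ y) [] reach-s₂ refl ⟨
      accepts ((x ++ v ++ y) ++ q)      ∎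
    where
    open ≡-Reasoning
    s₁ s₂ s₃ : State F
    s₁ = δ* F (s₀ F) x
    s₂ = δ* F s₁ y
    s₃ = δ F s₂ a
    v-loop : δ* F s₁ v ≡ s₁
    v-loop = trans (sym (δ*-++ (s₀ F) x v)) (sym unseen)
    reach-s₂ : δ* F (s₀ F) (x ++ v ++ y) ≡ s₂
    reach-s₂ = via x refl (via v v-loop refl)
    ya⊆v : y ++ [ a ] ⊆ₛ v
    ya⊆v c∈ = Sum.[ y⊆v , a∈v ] (∈-++⁻ y c∈)
    P₁-witness : Sep F s₂ s₃ q → P₁ F
    P₁-witness sep = v ^ length (y ++ [ a ]) , x , y , q , a , s₁ , s₂ , s₃ ,
                     ⊆ₛ⇒⊆^ (y ++ [ a ]) ya⊆v , refl , δ*-^ v (length (y ++ [ a ])) v-loop , refl , refl , sep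

  ¬P₂⇒absorbingˡ : ¬ P₂ F → Absorbingˡ (nStates F * nStates F) accepts
  ¬P₂⇒absorbingˡ ¬p₂ p a q sat
    with record { left = z ; loop = u ; right = z′ ; split = refl ; unseen = unseen } , a∈u , z⊆u
           ← loopˡ ≤-refl sat (here refl) (λ pre _ → combine (δ* F (δ* F (s₀ F) p) pre)
                                                           (δ* F (δ F (δ* F (s₀ F) p) a) pre)) = begin
      accepts (p ++ a ∷ z ++ u ++ z′)  ≡⟨ cong (final F) (via p refl (via z refl (via u u-loop₄ refl))) ⟩
      final F (δ* F s₄ z′)             ≡⟨ ¬Sep⇒≡ z′ (λ sep → ¬p₂ (P₂-witness sep)) ⟨
      final F (δ* F s₃ z′)             ≡⟨ cong (final F) (via p refl (via z refl (via u u-loop₃ refl))) ⟨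
      accepts (p ++ z ++ u ++ z′)      ∎
    where
    open ≡-Reasoning
    s₁ s₂ s₃ s₄ : State F
    s₁ = δ* F (s₀ F) p
    s₂ = δ F s₁ a
    s₃ = δ* F s₁ z
    s₄ = δ* F s₂ z
    u-loop₃ : δ* F s₃ u ≡ s₃
    u-loop₃ = trans (sym (δ*-++ s₁ z u)) (sym (combine-injectiveˡ s₃ s₄ _ _ unseen))
    u-loop₄ : δ* F s₄ u ≡ s₄
    u-loop₄ = trans (sym (δ*-++ s₂ z u)) (sym (combine-injectiveʳ s₃ s₄ _ _ unseen))
    az⊆u : a ∷ z ⊆ₛ u
    az⊆u (here refl) = a∈u (here refl)
    az⊆u (there c∈z) = z⊆u c∈z
    P₂-witness : Sep F s₃ s₄ z′ → P₂ F
    P₂-witness sep = u ^ length (a ∷ z) , p , z , z′ , a , s₁ , s₂ , s₃ , s₄ , ⊆ₛ⇒⊆^ (a ∷ z) az⊆u ,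
                     refl , refl , refl , δ*-^ u (length (a ∷ z)) u-loop₃ ,
                     refl , δ*-^ u (length (a ∷ z)) u-loop₄ , sep

theorem5p1 : (k : ℕ) → k ≥ 2 → (F F̂ : DFA k) →
    (∀ w → L F̂ w ⇔ (L F ᴿ) w) →
    (InL1 (L F) ⇔ (¬ P₁ F × ¬ P₁ F̂))
    × (InL1 (L F) ⇔ (¬ P₂ F × ¬ P₂ F̂))
    × (InL1 (L F) ⇔ (¬ P₃ F))
theorem5p1 k _ F F̂ L̂⇔Lᴿ =
    mk⇔ (λ inL → piecewiseTestable⇒¬P₁ F (testable inL) , piecewiseTestable⇒¬P₁ F̂ (testablê inL))
        (λ (¬p₁ , ¬p̂₁) → fromAbsorbing (¬P₁⇒absorbingʳ F ¬p₁) (¬P̂₁⇒absorbingˡ ¬p̂₁))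
  , mk⇔ (λ inL → piecewiseTestable⇒¬P₂ F (testable inL) , piecewiseTestable⇒¬P₂ F̂ (testablê inL))
        (λ (¬p₂ , ¬p̂₂) → fromAbsorbing (¬P̂₂⇒absorbingʳ ¬p̂₂) (¬P₂⇒absorbingˡ F ¬p₂))
  , mk⇔ (λ inL → Sum.[ piecewiseTestable⇒¬P₁ F (testable inL) , piecewiseTestable⇒¬P₂ F (testable inL) ]
                 ∘ P₃⇒P₁⊎P₂ F)
        (λ ¬p₃ → fromAbsorbing (¬P₁⇒absorbingʳ F (¬p₃ ∘ P₁⇒P₃ F)) (¬P₂⇒absorbingˡ F (¬p₃ ∘ P₂⇒P₃ F)))
  where
  open Equivalence
  K̂≡Kᴿ : ∀ w → accepts F̂ w ≡ accepts F (reverse w)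
  K̂≡Kᴿ w = ⇔→≡ (L̂⇔Lᴿ w)
  K≡K̂ᴿ : ∀ w → accepts F w ≡ accepts F̂ (reverse w)
  K≡K̂ᴿ w = trans (cong (accepts F) (sym (reverse-involutive w))) (sym (K̂≡Kᴿ (reverse w)))
  testable : InL1 (L F) → PiecewiseTestable (accepts F)
  testable = to InL1⇔piecewiseTestable
  testablê : InL1 (L F) → PiecewiseTestable (accepts F̂)
  testablê = PiecewiseTestable-reverse {K = accepts F} K̂≡Kᴿ ∘ testable
  ¬P̂₁⇒absorbingˡ : ¬ P₁ F̂ → Absorbingˡ (nStates F̂) (accepts F)
  ¬P̂₁⇒absorbingˡ = Absorbingʳ-reverse {K = accepts F̂} K≡K̂ᴿ ∘ ¬P₁⇒absorbingʳ F̂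
  ¬P̂₂⇒absorbingʳ : ¬ P₂ F̂ → Absorbingʳ (nStates F̂ * nStates F̂) (accepts F)
  ¬P̂₂⇒absorbingʳ = Absorbingˡ-reverse {K = accepts F̂} K≡K̂ᴿ ∘ ¬P₂⇒absorbingˡ F̂
  fromAbsorbing : ∀ {m n} → Absorbingʳ m (accepts F) → Absorbingˡ n (accepts F) → InL1 (L F)
  fromAbsorbing {m} {n} absʳ absˡ = from InL1⇔piecewiseTestable
    (_ , absorbing⇒invariant (Absorbingʳ-mono {K = accepts F} (m≤m⊔n m n) absʳ)
                             (Absorbingˡ-mono {K = accepts F} (m≤n⊔m m n) absˡ))
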